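{- Let $k \geq 3$ and let $p = p(n)$ satisfy $p = o(1/n^{k-1})$. Let $\mathcal{H} \sim \mathcal{H}_k(n,p)$ and $M=M(\mathcal{H})$. Then asymptotically almost surely the abelian group $\operatorname{coker}(M) = \mathbb{Z}^n/\operatorname{Im}(M)$ is torsion-free.
   Context: For a $k$-uniform hypergraph $\mathcal{H}$ on vertex set $[n]$, $M(\mathcal{H})$ is the integer matrix with rows indexed by vertices and columns indexed by hyperedges, where for a hyperedge $e=\{v_1<\cdots<v_k\}$ one sets $M(v_i,e)=(-1)^{i+1}$ and $M(v,e)=0$ for $v\notin e$. $\mathcal{H}_k(n,p)$ is the random $k$-uniform hypergraph on $[n]$ with each $k$-subset included independently with probability $p$.
   Formalization: The probability $p(n)$ takes rational values. -}

module Defs where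

open import Data.Bool using (Bool; true; false; if_then_else_)
open import Data.Nat using (ℕ; zero; suc; _≡ᵇ_)
open import Data.Nat.Properties using ()
open import Data.Fin using (Fin; zero; suc)
open import Data.Fin.Subset using (Subset; ∣_∣)
open import Data.Vec using (Vec; []; _∷_)
open import Data.List using (List; []; _∷_; _++_; map; length; filter; sum)
open import Data.Integer using (ℤ; +_; -_) renaming (_+_ to _+ℤ_; _*_ to _*ℤ_)
open import Data.Product using (Σ; ∃; _×_)
open import Relation.Binary.PropositionalEquality using (_≡_; _≢_)
open import Relation.Nullary using (¬_)
open import Data.Nat using (_≟_)
open import Relation.Nullary.Decidable using (⌊_⌋)
open import Data.Rational using (ℚ; 0ℚ; 1ℚ) renaming (_+_ to _+ℚ_; _*_ to _*ℚ_; _-_ to _-ℚ_)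

allSubsets : (m : ℕ) → List (Subset m)
allSubsets zero    = [] ∷ []
allSubsets (suc m) = map (false ∷_) (allSubsets m) ++ map (true ∷_) (allSubsets m)

-- all k-subsets of [n] = Fin n (vertex i : Fin n stands for vertex toℕ i + 1)
kSets : (n k : ℕ) → List (Subset n)
kSets n k = filter (λ s → ∣ s ∣ ≟ k) (allSubsets n)

numKSets : ℕ → ℕ → ℕ
numKSets n k = length (kSets n k)

-- k-uniform hypergraphs on [n]: a choice of which k-subsets are edges

Hypergraph : ℕ → ℕ → Set
Hypergraph n k = Subset (numKSets n k)

select : {A : Set} {m : ℕ} → Subset m → (xs : List A) → List A
select {m = zero}  []          xs       = []
select {m = suc m} (b ∷ bs)    []       = []
select {m = suc m} (true ∷ bs) (x ∷ xs) = x ∷ select bs xs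
select {m = suc m} (false ∷ bs) (x ∷ xs) = select bs xs

edges : {n k : ℕ} → Hypergraph n k → List (Subset n)
edges {n} {k} H = select H (kSets n k)

below : {n : ℕ} → Fin n → Subset n → ℕ
below zero    (b ∷ e)     = 0
below (suc v) (false ∷ e) = below v e
below (suc v) (true ∷ e)  = suc (below v e)

member : {n : ℕ} → Fin n → Subset n → Bool
member zero    (b ∷ e) = b
member (suc v) (b ∷ e) = member v e

even : ℕ → Bool
even zero          = true
even (suc zero)    = false
even (suc (suc m)) = even m

-- M(v,e) = (-1)^(i+1) if v is the i-th smallest element of e (i ≥ 1), else 0
Mentry : {n : ℕ} → Fin n → Subset n → ℤ
Mentry v e = if member v e
             then (if even (below v e) then + 1 else - (+ 1))
             else + 0

-- (M y)(v) where the columns of M are the hyperedges in the list es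
applyM : {n : ℕ} → (es : List (Subset n)) → (Fin (length es) → ℤ) → Fin n → ℤ
applyM []       y v = + 0
applyM (e ∷ es) y v = (Mentry v e *ℤ y zero) +ℤ applyM es (λ j → y (suc j)) v

InImage : {n k : ℕ} → Hypergraph n k → (Fin n → ℤ) → Set
InImage {n} {k} H x = ∃ λ (y : Fin (length (edges {n} {k} H)) → ℤ) → ∀ v → x v ≡ applyM (edges {n} {k} H) y v

-- coker(M(H)) = ℤ^n / Im(M(H)) is torsion-free:
-- no nonzero class [x] with m·[x] = 0 for some integer m ≠ 0
CokerTorsionFree : {n k : ℕ} → Hypergraph n k → Set
CokerTorsionFree {n} {k} H =
  ∀ (x : Fin n → ℤ) (m : ℤ) → m ≢ + 0 →
    InImage {n} {k} H (λ v → m *ℤ x v) → InImage {n} {k} H x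

weight : {m : ℕ} → ℚ → Subset m → ℚ
weight p []          = 1ℚ
weight p (true ∷ s)  = p *ℚ weight p s
weight p (false ∷ s) = (1ℚ -ℚ p) *ℚ weight p s

probTrue : (n k : ℕ) → ℚ → (Hypergraph n k → Bool) → ℚ
probTrue n k p good = sumℚ (allSubsets (numKSets n k))
  where
  sumℚ : List (Hypergraph n k) → ℚ
  sumℚ []       = 0ℚ
  sumℚ (H ∷ Hs) = (if good H then weight p H else 0ℚ) +ℚ sumℚ Hs

module Submission where

-- If every vertex of a family of distinct edges, each of size at least 2, lies in two of them,
-- a walk from edge to edge through shared vertices eventually repeats an edge, closing a Berge
-- cycle. Otherwise some vertex v lies in a single edge e: in row v the column of e is the only
-- nonzero entry and is ±1, so the coefficient of e in a preimage of m·x is forced to be a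
-- multiple of m and e can be peeled off. By induction coker M(H) is torsion-free whenever H has
-- no Berge cycle. A Berge cycle of length l is determined by l blocks of k − 1 vertices, so
-- there are at most n^((k−1)l) candidates, each present with probability p^l, and the union
-- bound gives P(H has a Berge cycle) ≤ ∑_{l ≥ 1} (p·n^(k−1))^l ≤ 2·p·n^(k−1) → 0.

open import Defs
open import Data.Nat using (ℕ)
open import Data.Rational using (ℚ; 0ℚ; 1ℚ)
import Data.Rational as ℚ

module Lists where

  open import Data.Bool using (true; false)
  open import Data.Fin.Subset using (Subset)
  open import Data.List using (List; []; _∷_; _++_; map; length; concatMap)
  open import Data.List.Properties using (length-++; length-map; length-++-sucʳ)
  open import Data.List.Membership.Propositional using (_∈_; _∉_)
  open import Data.List.Membership.Propositional.Properties
    using (∈-∃++; ∈-++⁺ʳ; ∈-map⁺; ∈-map⁻; ∈-concatMap⁺; ∈-concatMap⁻)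
  open import Data.List.Relation.Unary.All as All using (All; []; _∷_)
  open import Data.List.Relation.Unary.All.Properties using (All¬⇒¬Any)
  open import Data.List.Relation.Unary.Any as Any using (here; there)
  open import Data.List.Relation.Unary.Unique.Propositional using (Unique; []; _∷_)
  open import Data.Nat using (ℕ; zero; suc; _+_; _*_; _^_; _≤_; z≤n; s≤s)
  open import Data.Product using (_×_; _,_)
  open import Data.Vec using ([]; _∷_)
  open import Function using (_∘_)
  open import Relation.Binary.PropositionalEquality using (_≡_; _≢_; refl; sym; trans; cong; cong₂; subst)
  open import Relation.Nullary using (contradiction)

  private variable
    A : Set

  ∈-remove : {x y : A} (as : List A) {bs : List A} → y ≢ x → y ∈ as ++ x ∷ bs → y ∈ as ++ bs
  ∈-remove []       y≢x (here y≡x)  = contradiction y≡x y≢x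
  ∈-remove []       y≢x (there y∈)  = y∈
  ∈-remove (a ∷ as) y≢x (here y≡a)  = here y≡a
  ∈-remove (a ∷ as) y≢x (there y∈)  = there (∈-remove as y≢x y∈)

  ∈-insert : {x y : A} (as : List A) {bs : List A} → y ∈ as ++ bs → y ∈ as ++ x ∷ bs
  ∈-insert []       y∈         = there y∈
  ∈-insert (a ∷ as) (here y≡a) = here y≡a
  ∈-insert (a ∷ as) (there y∈) = there (∈-insert as y∈)

  Unique-remove : (as : List A) {e : A} {bs : List A} →
                  Unique (as ++ e ∷ bs) → e ∉ as ++ bs × Unique (as ++ bs)
  Unique-remove []       (e∉bs ∷ u) = All¬⇒¬Any e∉bs , u
  Unique-remove (a ∷ as) {e} {bs} (a∉ ∷ u) with e∉ , u′ ← Unique-remove as u =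
    e∉a∷ , All.tabulate (λ y∈ → All.lookup a∉ (∈-insert as y∈)) ∷ u′
    where
    e∉a∷ : e ∉ a ∷ as ++ bs
    e∉a∷ (here e≡a) = All.lookup a∉ (∈-++⁺ʳ as (here refl)) (sym e≡a)
    e∉a∷ (there e∈) = e∉ e∈

  Unique⇒length≤ : {xs ys : List A} → Unique xs → (∀ {x} → x ∈ xs → x ∈ ys) → length xs ≤ length ys
  Unique⇒length≤ {xs = []}     []         xs⊆ys = z≤n
  Unique⇒length≤ {xs = x ∷ xs} (x∉ ∷ u)   xs⊆ys with as , bs , refl ← ∈-∃++ (xs⊆ys (here refl)) =
    subst (suc (length xs) ≤_) (sym (length-++-sucʳ as x bs))
          (s≤s (Unique⇒length≤ u λ y∈xs →
                 ∈-remove as (λ y≡x → All.lookup x∉ y∈xs (sym y≡x)) (xs⊆ys (there y∈xs))))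

  select-⊆ : {xs : List A} (H : Subset (length xs)) {f : A} → f ∈ select H xs → f ∈ xs
  select-⊆ {xs = []}     []          ()
  select-⊆ {xs = x ∷ xs} (true ∷ H)  (here f≡x)  = here f≡x
  select-⊆ {xs = x ∷ xs} (true ∷ H)  (there f∈)  = there (select-⊆ H f∈)
  select-⊆ {xs = x ∷ xs} (false ∷ H) f∈          = there (select-⊆ H f∈)

  Unique-select : {xs : List A} (H : Subset (length xs)) → Unique xs → Unique (select H xs)
  Unique-select {xs = []}     []          []         = []
  Unique-select {xs = x ∷ xs} (true ∷ H)  (x∉ ∷ u)  = All.tabulate (All.lookup x∉ ∘ select-⊆ H) ∷ Unique-select H u
  Unique-select {xs = x ∷ xs} (false ∷ H) (x∉ ∷ u)  = Unique-select H u

  lists : List A → ℕ → List (List A)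
  lists as zero    = [] ∷ []
  lists as (suc j) = concatMap (λ a → map (a ∷_) (lists as j)) as

  ∈-lists⁺ : {as xs : List A} → All (_∈ as) xs → xs ∈ lists as (length xs)
  ∈-lists⁺             []            = here refl
  ∈-lists⁺ {as = as} {x ∷ xs} (x∈as ∷ xs∈) =
    ∈-concatMap⁺ (λ a → map (a ∷_) (lists as (length xs)))
                 (Any.map (λ { refl → ∈-map⁺ (x ∷_) (∈-lists⁺ xs∈) }) x∈as)

  ∈-lists⁻ : (as : List A) (j : ℕ) {xs : List A} → xs ∈ lists as j → length xs ≡ j
  ∈-lists⁻ as zero    (here refl) = refl
  ∈-lists⁻ as (suc j) xs∈
    with a , xs∈′ ← Any.satisfied (∈-concatMap⁻ (λ a → map (a ∷_) (lists as j)) {xs = as} xs∈)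
    with ys , ys∈ , refl ← ∈-map⁻ (a ∷_) xs∈′ = cong suc (∈-lists⁻ as j ys∈)

  length-lists : (as : List A) (j : ℕ) → length (lists as j) ≡ length as ^ j
  length-lists as zero    = refl
  length-lists as (suc j) = length-concat as
    where
    length-concat : ∀ bs → length (concatMap (λ a → map (a ∷_) (lists as j)) bs) ≡ length bs * length as ^ j
    length-concat []       = refl
    length-concat (b ∷ bs) =
      trans (length-++ (map (b ∷_) (lists as j)))
            (cong₂ _+_ (trans (length-map (b ∷_) (lists as j)) (length-lists as j)) (length-concat bs))

module FinSubsets where

  open Lists
  open import Data.Bool using (Bool; true; false; not; _∧_; _∨_)
  open import Data.Bool.Properties using (¬-not)
  open import Data.Fin using (Fin; zero; suc; _≟_)
  open import Data.Fin.Properties using (suc-injective)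
  open import Data.Fin.Subset using (Subset; ∣_∣; ⊥)
  open import Data.List using (List; []; _∷_; map; length; filter)
  open import Data.List.Properties using (length-map)
  open import Data.List.Membership.Propositional using (_∈_)
  open import Data.List.Membership.Propositional.Properties using (∈-map⁺; ∈-map⁻; ∈-filter⁻)
  open import Data.List.Relation.Binary.Disjoint.Propositional using (Disjoint)
  open import Data.List.Relation.Unary.All as All using ([]; _∷_)
  open import Data.List.Relation.Unary.Any using (here; there)
  open import Data.List.Relation.Unary.Unique.Propositional using (Unique; []; _∷_)
  import Data.List.Relation.Unary.Unique.Propositional.Properties as Unique
  open import Data.Nat using (ℕ; zero; suc; _≤_; z≤n; s≤s)
  import Data.Nat as ℕ
  open import Data.Nat.Properties using (≤-trans; ≤-pred)
  open import Data.Product using (∃; _×_; _,_; proj₂)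
  open import Data.Vec using ([]; _∷_)
  open import Function using (_∘_)
  open import Relation.Binary.PropositionalEquality
    using (_≡_; _≢_; refl; sym; trans; cong; cong₂; module ≡-Reasoning)
  open import Relation.Nullary using (Dec; yes; no; does; contradiction)
  open import Relation.Unary using (Decidable)

  private variable
    A : Set
    n : ℕ

  insert : Fin n → Subset n → Subset n
  insert zero    (b ∷ S) = true ∷ S
  insert (suc i) (b ∷ S) = b ∷ insert i S

  remove : Fin n → Subset n → Subset n
  remove zero    (b ∷ S) = false ∷ S
  remove (suc i) (b ∷ S) = b ∷ remove i S

  empty : (n : ℕ) → Subset n
  empty zero    = []
  empty (suc n) = false ∷ empty n

  fromList : List (Fin n) → Subset n
  fromList {n} []       = empty n
  fromList     (i ∷ is) = insert i (fromList is)

  toList : Subset n → List (Fin n)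
  toList []          = []
  toList (true ∷ S)  = zero ∷ map suc (toList S)
  toList (false ∷ S) = map suc (toList S)

  member-empty : (i : Fin n) → member i (empty n) ≡ false
  member-empty zero    = refl
  member-empty (suc i) = member-empty i

  member-insert-≡ : (i : Fin n) (S : Subset n) → member i (insert i S) ≡ true
  member-insert-≡ zero    (b ∷ S) = refl
  member-insert-≡ (suc i) (b ∷ S) = member-insert-≡ i S

  member-insert-≢ : {i j : Fin n} (S : Subset n) → i ≢ j → member i (insert j S) ≡ member i S
  member-insert-≢ {i = zero}  {zero}  (b ∷ S) i≢j = contradiction refl i≢j
  member-insert-≢ {i = zero}  {suc j} (b ∷ S) i≢j = refl
  member-insert-≢ {i = suc i} {zero}  (b ∷ S) i≢j = refl
  member-insert-≢ {i = suc i} {suc j} (b ∷ S) i≢j = member-insert-≢ S (i≢j ∘ cong suc)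

  member-remove-≢ : {i j : Fin n} (S : Subset n) → i ≢ j → member i (remove j S) ≡ member i S
  member-remove-≢ {i = zero}  {zero}  (b ∷ S) i≢j = contradiction refl i≢j
  member-remove-≢ {i = zero}  {suc j} (b ∷ S) i≢j = refl
  member-remove-≢ {i = suc i} {zero}  (b ∷ S) i≢j = refl
  member-remove-≢ {i = suc i} {suc j} (b ∷ S) i≢j = member-remove-≢ S (i≢j ∘ cong suc)

  member-ext : {S T : Subset n} → (∀ i → member i S ≡ member i T) → S ≡ T
  member-ext {S = []}    {[]}    S≗T = refl
  member-ext {S = a ∷ S} {b ∷ T} S≗T = cong₂ _∷_ (S≗T zero) (member-ext (S≗T ∘ suc))

  ∣remove∣ : (i : Fin n) (S : Subset n) → member i S ≡ true → suc ∣ remove i S ∣ ≡ ∣ S ∣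
  ∣remove∣ zero    (true ∷ S)  i∈S = refl
  ∣remove∣ (suc i) (true ∷ S)  i∈S = cong suc (∣remove∣ i S i∈S)
  ∣remove∣ (suc i) (false ∷ S) i∈S = ∣remove∣ i S i∈S

  ∈-fromList⁺ : {i : Fin n} {is : List (Fin n)} → i ∈ is → member i (fromList is) ≡ true
  ∈-fromList⁺ {i = i} {j ∷ is} i∈ with i ≟ j
  ... | yes refl = member-insert-≡ i (fromList is)
  ... | no  i≢j  with i∈
  ...   | here i≡j  = contradiction i≡j i≢j
  ...   | there i∈′ = trans (member-insert-≢ (fromList is) i≢j) (∈-fromList⁺ i∈′)

  ∈-fromList⁻ : {i : Fin n} (is : List (Fin n)) → member i (fromList is) ≡ true → i ∈ is
  ∈-fromList⁻ {i = i} []       i∈ = contradiction (trans (sym (member-empty i)) i∈) λ ()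
  ∈-fromList⁻ {i = i} (j ∷ is) i∈ with i ≟ j
  ... | yes i≡j = here i≡j
  ... | no  i≢j = there (∈-fromList⁻ is (trans (sym (member-insert-≢ (fromList is) i≢j)) i∈))

  ∈-toList⁺ : {i : Fin n} (S : Subset n) → member i S ≡ true → i ∈ toList S
  ∈-toList⁺ {i = zero}  (true ∷ S)  i∈ = here refl
  ∈-toList⁺ {i = suc i} (true ∷ S)  i∈ = there (∈-map⁺ suc (∈-toList⁺ S i∈))
  ∈-toList⁺ {i = suc i} (false ∷ S) i∈ = ∈-map⁺ suc (∈-toList⁺ S i∈)

  ∈-toList⁻ : {i : Fin n} (S : Subset n) → i ∈ toList S → member i S ≡ true
  ∈-toList⁻ {i = zero}  (true ∷ S)  i∈         = refl
  ∈-toList⁻ {i = suc i} (true ∷ S)  (there i∈) = ∈-toList⁻-suc S i∈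
    where
    ∈-toList⁻-suc : ∀ S → suc i ∈ map suc (toList S) → member i S ≡ true
    ∈-toList⁻-suc S i∈ with j , j∈ , si≡sj ← ∈-map⁻ suc i∈ rewrite suc-injective si≡sj = ∈-toList⁻ S j∈
  ∈-toList⁻ {i = i}     (false ∷ S) i∈         with j , j∈ , refl ← ∈-map⁻ suc i∈ = ∈-toList⁻ S j∈

  length-toList : (S : Subset n) → length (toList S) ≡ ∣ S ∣
  length-toList []          = refl
  length-toList (true ∷ S)  = cong suc (trans (length-map suc (toList S)) (length-toList S))
  length-toList (false ∷ S) = trans (length-map suc (toList S)) (length-toList S)

  fromList-toList : (S : Subset n) → fromList (toList S) ≡ S
  fromList-toList S = member-ext λ i → lemma i (member i S) refl
    where
    lemma : ∀ i b → member i S ≡ b → member i (fromList (toList S)) ≡ b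
    lemma i true  i∈S = ∈-fromList⁺ (∈-toList⁺ {i = i} S i∈S)
    lemma i false i∉S = ¬-not {y = true} λ i∈ →
      contradiction (trans (sym (∈-toList⁻ {i = i} S (∈-fromList⁻ (toList S) i∈))) i∉S) λ ()

  splitEdge : {w w′ : Fin n} (S : Subset n) → member w S ≡ true → member w′ S ≡ true → w ≢ w′ →
              ∃ λ xs → fromList (w′ ∷ w ∷ xs) ≡ S × suc (suc (length xs)) ≡ ∣ S ∣
  splitEdge {w = w} {w′} S w∈S w′∈S w≢w′ = toList S₂ , member-ext sameMembers , size
    where
    S₁ = remove w S
    S₂ = remove w′ S₁
    w′∈S₁ : member w′ S₁ ≡ true
    w′∈S₁ = trans (member-remove-≢ S (w≢w′ ∘ sym)) w′∈S
    size : suc (suc (length (toList S₂))) ≡ ∣ S ∣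
    size = trans (cong (λ m → suc (suc m)) (length-toList S₂))
                 (trans (cong suc (∣remove∣ w′ S₁ w′∈S₁)) (∣remove∣ w S w∈S))
    R = fromList (toList S₂)
    sameMembers : ∀ i → member i (insert w′ (insert w R)) ≡ member i S
    sameMembers i with i ≟ w′ | i ≟ w
    ... | yes refl | _        = trans (member-insert-≡ i (insert w R)) (sym w′∈S)
    ... | no  i≢w′ | yes refl = trans (member-insert-≢ (insert i R) i≢w′) (trans (member-insert-≡ i R) (sym w∈S))
    ... | no  i≢w′ | no  i≢w  = begin
      member i (insert w′ (insert w R)) ≡⟨ member-insert-≢ (insert w R) i≢w′ ⟩
      member i (insert w R)             ≡⟨ member-insert-≢ R i≢w ⟩
      member i R                        ≡⟨ cong (member i) (fromList-toList S₂) ⟩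
      member i (remove w′ (remove w S)) ≡⟨ member-remove-≢ S₁ i≢w′ ⟩
      member i (remove w S)             ≡⟨ member-remove-≢ S i≢w ⟩
      member i S                        ∎
      where open ≡-Reasoning

  element : (S : Subset n) → 1 ≤ ∣ S ∣ → ∃ λ b → member b S ≡ true
  element (true ∷ S)  _   = zero , refl
  element (false ∷ S) 1≤∣S∣ with b , b∈S ← element S 1≤∣S∣ = suc b , b∈S

  otherElement : (S : Subset n) → 2 ≤ ∣ S ∣ → ∀ a → ∃ λ b → member b S ≡ true × b ≢ a
  otherElement (true ∷ S)  2≤∣S∣ (suc a) = zero , refl , λ ()
  otherElement (true ∷ S)  2≤∣S∣ zero    with b , b∈S ← element S (≤-pred 2≤∣S∣) = suc b , b∈S , λ ()
  otherElement (false ∷ S) 2≤∣S∣ zero    with b , b∈S ← element S (≤-trans (s≤s z≤n) 2≤∣S∣) = suc b , b∈S , λ ()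
  otherElement (false ∷ S) 2≤∣S∣ (suc a) with b , b∈S , b≢a ← otherElement S 2≤∣S∣ a =
    suc b , b∈S , b≢a ∘ suc-injective

  _⊆ᵇ_ : Subset n → Subset n → Bool
  []      ⊆ᵇ []      = true
  (q ∷ Q) ⊆ᵇ (h ∷ H) = (not q ∨ h) ∧ (Q ⊆ᵇ H)

  ∅⊆ᵇ : (H : Subset n) → ⊥ ⊆ᵇ H ≡ true
  ∅⊆ᵇ []      = refl
  ∅⊆ᵇ (h ∷ H) = ∅⊆ᵇ H

  Unique-allSubsets : (m : ℕ) → Unique (allSubsets m)
  Unique-allSubsets zero    = [] ∷ []
  Unique-allSubsets (suc m) =
    Unique.++⁺ (Unique.map⁺ ∷-injective (Unique-allSubsets m)) (Unique.map⁺ ∷-injective (Unique-allSubsets m))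
               disjoint
    where
    ∷-injective : {b : Bool} {S T : Subset m} → b ∷ S ≡ b ∷ T → S ≡ T
    ∷-injective refl = refl
    disjoint : Disjoint (map (false ∷_) (allSubsets m)) (map (true ∷_) (allSubsets m))
    disjoint (S∈₀ , S∈₁) with _ , _ , refl ← ∈-map⁻ (false ∷_) S∈₀ with _ , _ , () ← ∈-map⁻ (true ∷_) S∈₁

  Unique-kSets : (n k : ℕ) → Unique (kSets n k)
  Unique-kSets n k = Unique.filter⁺ (λ s → ∣ s ∣ ℕ.≟ k) (Unique-allSubsets n)

  ∈-kSets⁻ : {n k : ℕ} {s : Subset n} → s ∈ kSets n k → ∣ s ∣ ≡ k
  ∈-kSets⁻ {n} {k} = proj₂ ∘ ∈-filter⁻ (λ s → ∣ s ∣ ℕ.≟ k) {xs = allSubsets n}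

  indicator : {P : A → Set} → Decidable P → (xs : List A) → Subset (length xs)
  indicator P? []       = []
  indicator P? (x ∷ xs) = does (P? x) ∷ indicator P? xs

  ∣indicator∣ : {P : A → Set} (P? : Decidable P) (xs : List A) → ∣ indicator P? xs ∣ ≡ length (filter P? xs)
  ∣indicator∣ P? []       = refl
  ∣indicator∣ P? (x ∷ xs) with does (P? x)
  ... | true  = cong suc (∣indicator∣ P? xs)
  ... | false = ∣indicator∣ P? xs

  indicator-⊆ᵇ : {P : A → Set} (P? : Decidable P) {xs : List A} (H : Subset (length xs)) → Unique xs →
                 (∀ {x} → x ∈ xs → P x → x ∈ select H xs) → indicator P? xs ⊆ᵇ H ≡ true
  indicator-⊆ᵇ P? {[]}     []      []       selected = refl
  indicator-⊆ᵇ {P = P} P? {x ∷ xs} (h ∷ H) (x∉ ∷ u) selected =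
    cong₂ _∧_ (head h (P? x) (selected (here refl)))
              (indicator-⊆ᵇ P? H u λ y∈ Py → dropHead h (All.lookup x∉ y∈) (selected (there y∈) Py))
    where
    dropHead : ∀ h {y} → x ≢ y → y ∈ select (h ∷ H) (x ∷ xs) → y ∈ select H xs
    dropHead true  x≢y (here y≡x) = contradiction (sym y≡x) x≢y
    dropHead true  x≢y (there y∈) = y∈
    dropHead false x≢y y∈         = y∈
    head : ∀ h → (Px? : Dec (P x)) → (P x → x ∈ select (h ∷ H) (x ∷ xs)) → not (does Px?) ∨ h ≡ true
    head h     (no  _)  _        = refl
    head true  (yes _)  _        = refl
    head false (yes Px) selected = contradiction refl (All.lookup x∉ (select-⊆ H (selected Px)))

module Sums where

  open Lists using (lists)
  open import Algebra.Bundles using (CommutativeRing)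
  import Data.Integer as ℤ
  import Data.Integer.Properties as ℤ
  open import Data.List using (List; []; _∷_; _++_; map; length; concatMap; filter; applyDownFrom)
  open import Data.List.Membership.Propositional using (_∈_)
  open import Data.List.Relation.Unary.Any using (Any; here; there)
  open import Data.Nat using (ℕ; zero; suc)
  import Data.Nat as ℕ
  open import Data.Rational using (ℚ; 0ℚ; 1ℚ; _+_; _*_; _/_; _≤_; nonNegative; toℚᵘ)
  open import Data.Rational.Properties
  open import Data.Rational.Solver using (module +-*-Solver)
  import Data.Rational.Unnormalised as ℚᵘ
  import Data.Rational.Unnormalised.Properties as ℚᵘ
  open import Function using (_∘_)
  open import Relation.Binary.PropositionalEquality
    using (_≡_; refl; sym; trans; cong; cong₂; subst; module ≡-Reasoning)
  open import Relation.Nullary using (yes; no)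
  open import Relation.Unary using (Decidable)
  open +-*-Solver

  open import Algebra.Properties.CommutativeSemiring.Exp
    (CommutativeRing.commutativeSemiring +-*-commutativeRing)
    public using (^-distrib-*) renaming (_^_ to _^ℚ_)

  private variable
    A X Y : Set

  ≤-+ʳ : {a b : ℚ} → 0ℚ ≤ b → a ≤ a + b
  ≤-+ʳ {a} {b} 0≤b = subst (_≤ a + b) (+-identityʳ a) (+-monoʳ-≤ a 0≤b)

  ≤-+ˡ : {a b : ℚ} → 0ℚ ≤ a → b ≤ a + b
  ≤-+ˡ {a} {b} 0≤a = subst (_≤ a + b) (+-identityˡ b) (+-monoˡ-≤ b 0≤a)

  0≤* : {a b : ℚ} → 0ℚ ≤ a → 0ℚ ≤ b → 0ℚ ≤ a * b
  0≤* {a} {b} 0≤a 0≤b =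
    nonNegative⁻¹ (a * b) {{nonNeg*nonNeg⇒nonNeg a {{nonNegative 0≤a}} b {{nonNegative 0≤b}}}}

  m+1/1≡1+m/1 : ∀ m → ℤ.+ suc m / 1 ≡ 1ℚ + ℤ.+ m / 1
  m+1/1≡1+m/1 m = toℚᵘ-injective (begin
    toℚᵘ (ℤ.+ suc m / 1)             ≈⟨ toℚᵘ-fromℚᵘ (ℚᵘ.mkℚᵘ (ℤ.+ suc m) 0) ⟩
    ℚᵘ.mkℚᵘ (ℤ.+ suc m) 0            ≈⟨ ℚᵘ.*≡* (trans (ℤ.*-identityʳ (ℤ.+ suc m))
                                                 (sym (trans (ℤ.*-identityʳ _) (cong (ℤ._+_ (ℤ.+ 1)) (ℤ.*-identityʳ (ℤ.+ m)))))) ⟩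
    toℚᵘ 1ℚ ℚᵘ.+ ℚᵘ.mkℚᵘ (ℤ.+ m) 0    ≈⟨ ℚᵘ.+-congʳ (toℚᵘ 1ℚ)
                                                  (ℚᵘ.≃-sym (toℚᵘ-fromℚᵘ (ℚᵘ.mkℚᵘ (ℤ.+ m) 0))) ⟩
    toℚᵘ 1ℚ ℚᵘ.+ toℚᵘ (ℤ.+ m / 1)     ≈⟨ ℚᵘ.≃-sym (toℚᵘ-homo-+ 1ℚ (ℤ.+ m / 1)) ⟩
    toℚᵘ (1ℚ + ℤ.+ m / 1)             ∎)
    where open ℚᵘ.≃-Reasoning

  ∑ : (X → ℚ) → List X → ℚ
  ∑ f []       = 0ℚ
  ∑ f (x ∷ xs) = f x + ∑ f xs

  ∑-unique : {F : List X → ℚ} (f : X → ℚ) → F [] ≡ 0ℚ → (∀ x xs → F (x ∷ xs) ≡ f x + F xs) →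
             ∀ xs → F xs ≡ ∑ f xs
  ∑-unique f F[] F∷ []       = F[]
  ∑-unique f F[] F∷ (x ∷ xs) = trans (F∷ x xs) (cong (f x +_) (∑-unique f F[] F∷ xs))

  ∑-cong : {f g : X → ℚ} → (∀ x → f x ≡ g x) → ∀ xs → ∑ f xs ≡ ∑ g xs
  ∑-cong f≗g []       = refl
  ∑-cong f≗g (x ∷ xs) = cong₂ _+_ (f≗g x) (∑-cong f≗g xs)

  ∑-++ : (f : X → ℚ) (xs ys : List X) → ∑ f (xs ++ ys) ≡ ∑ f xs + ∑ f ys
  ∑-++ f []       ys = sym (+-identityˡ _)
  ∑-++ f (x ∷ xs) ys = trans (cong (f x +_) (∑-++ f xs ys)) (sym (+-assoc (f x) _ _))

  ∑-concatMap : (f : X → ℚ) (g : Y → List X) (ys : List Y) →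
                ∑ f (concatMap g ys) ≡ ∑ (λ y → ∑ f (g y)) ys
  ∑-concatMap f g []       = refl
  ∑-concatMap f g (y ∷ ys) = trans (∑-++ f (g y) _) (cong (∑ f (g y) +_) (∑-concatMap f g ys))

  ∑-map : (f : X → ℚ) (g : Y → X) (ys : List Y) → ∑ f (map g ys) ≡ ∑ (λ y → f (g y)) ys
  ∑-map f g []       = refl
  ∑-map f g (y ∷ ys) = cong (f (g y) +_) (∑-map f g ys)

  ∑-zero : (xs : List X) → ∑ (λ _ → 0ℚ) xs ≡ 0ℚ
  ∑-zero []       = refl
  ∑-zero (x ∷ xs) = trans (+-identityˡ _) (∑-zero xs)

  ∑-+ : (f g : X → ℚ) (xs : List X) → ∑ (λ x → f x + g x) xs ≡ ∑ f xs + ∑ g xs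
  ∑-+ f g []       = sym (+-identityˡ 0ℚ)
  ∑-+ f g (x ∷ xs) = begin
    (f x + g x) + ∑ (λ x → f x + g x) xs ≡⟨ cong (f x + g x +_) (∑-+ f g xs) ⟩
    (f x + g x) + (∑ f xs + ∑ g xs)      ≡⟨ solve 4 (λ a b c d → (a :+ b) :+ (c :+ d) := (a :+ c) :+ (b :+ d))
                                                     refl (f x) (g x) (∑ f xs) (∑ g xs) ⟩
    (f x + ∑ f xs) + (g x + ∑ g xs)      ∎
    where open ≡-Reasoning

  ∑-*ˡ : (a : ℚ) (f : X → ℚ) (xs : List X) → ∑ (λ x → a * f x) xs ≡ a * ∑ f xs
  ∑-*ˡ a f []       = sym (*-zeroʳ a)
  ∑-*ˡ a f (x ∷ xs) = trans (cong (a * f x +_) (∑-*ˡ a f xs)) (sym (*-distribˡ-+ a (f x) _))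

  # : List X → ℚ
  # = ∑ (λ _ → 1ℚ)

  #≡length : (xs : List X) → # xs ≡ ℤ.+ length xs / 1
  #≡length []       = refl
  #≡length (x ∷ xs) = trans (cong (1ℚ +_) (#≡length xs)) (sym (m+1/1≡1+m/1 (length xs)))

  ∑-const : (c : ℚ) (xs : List X) → ∑ (λ _ → c) xs ≡ # xs * c
  ∑-const c []       = sym (*-zeroˡ c)
  ∑-const c (x ∷ xs) = begin
    c + ∑ (λ _ → c) xs     ≡⟨ cong₂ _+_ (sym (*-identityˡ c)) (∑-const c xs) ⟩
    1ℚ * c + # xs * c      ≡⟨ sym (*-distribʳ-+ c 1ℚ (# xs)) ⟩
    (1ℚ + # xs) * c        ∎
    where open ≡-Reasoning

  ∑-swap : (f : X → Y → ℚ) (xs : List X) (ys : List Y) →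
           ∑ (λ x → ∑ (f x) ys) xs ≡ ∑ (λ y → ∑ (λ x → f x y) xs) ys
  ∑-swap f []       ys = sym (∑-zero ys)
  ∑-swap f (x ∷ xs) ys =
    trans (cong (∑ (f x) ys +_) (∑-swap f xs ys)) (sym (∑-+ (f x) _ ys))

  ∑-nonneg : {f : X → ℚ} → (∀ x → 0ℚ ≤ f x) → ∀ xs → 0ℚ ≤ ∑ f xs
  ∑-nonneg 0≤f []       = ≤-refl
  ∑-nonneg 0≤f (x ∷ xs) = +-mono-≤ (0≤f x) (∑-nonneg 0≤f xs)

  ∑-mono : {f g : X → ℚ} (xs : List X) → (∀ {x} → x ∈ xs → f x ≤ g x) → ∑ f xs ≤ ∑ g xs
  ∑-mono []       f≤g = ≤-refl
  ∑-mono (x ∷ xs) f≤g = +-mono-≤ (f≤g (here refl)) (∑-mono xs (f≤g ∘ there))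

  ∑-filter-mono : {f g : X → ℚ} {P : X → Set} (P? : Decidable P) → (∀ x → 0ℚ ≤ g x) →
                  (xs : List X) → (∀ {x} → x ∈ xs → P x → f x ≤ g x) → ∑ f (filter P? xs) ≤ ∑ g xs
  ∑-filter-mono P? 0≤g []       f≤g = ≤-refl
  ∑-filter-mono P? 0≤g (x ∷ xs) f≤g with P? x
  ... | yes px = +-mono-≤ (f≤g (here refl) px) (∑-filter-mono P? 0≤g xs (f≤g ∘ there))
  ... | no  _  = ≤-trans (∑-filter-mono P? 0≤g xs (f≤g ∘ there)) (≤-+ˡ (0≤g x))

  ∑-≥-Any : {f : X → ℚ} {P : X → Set} {c : ℚ} → (∀ x → 0ℚ ≤ f x) → (∀ {x} → P x → c ≤ f x) →
            ∀ {xs} → Any P xs → c ≤ ∑ f xs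
  ∑-≥-Any 0≤f c≤f {x ∷ xs} (here px)  = ≤-trans (c≤f px) (≤-+ʳ (∑-nonneg 0≤f xs))
  ∑-≥-Any 0≤f c≤f {x ∷ xs} (there pxs) = ≤-trans (∑-≥-Any 0≤f c≤f pxs) (≤-+ˡ (0≤f x))

  0≤^ : {a : ℚ} → 0ℚ ≤ a → ∀ j → 0ℚ ≤ a ^ℚ j
  0≤^ 0≤a zero    = nonNegative⁻¹ 1ℚ
  0≤^ 0≤a (suc j) = 0≤* 0≤a (0≤^ 0≤a j)

  ^-suc≤ : {a : ℚ} → 0ℚ ≤ a → a ≤ 1ℚ → ∀ j → a ^ℚ suc j ≤ a ^ℚ j
  ^-suc≤ {a} 0≤a a≤1 j = subst (a * a ^ℚ j ≤_) (*-identityˡ (a ^ℚ j))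
                               (*-monoʳ-≤-nonNeg (a ^ℚ j) {{nonNegative (0≤^ 0≤a j)}} a≤1)

  ^-antitone : {a : ℚ} → 0ℚ ≤ a → a ≤ 1ℚ → ∀ {i j} → i ℕ.≤ j → a ^ℚ j ≤ a ^ℚ i
  ^-antitone 0≤a a≤1 {zero}  {zero}  _           = ≤-refl
  ^-antitone 0≤a a≤1 {zero}  {suc j} _           = ≤-trans (^-suc≤ 0≤a a≤1 j) (^-antitone 0≤a a≤1 {zero} {j} ℕ.z≤n)
  ^-antitone {a} 0≤a a≤1 {suc i} {suc j} (ℕ.s≤s i≤j) =
    *-monoˡ-≤-nonNeg a {{nonNegative 0≤a}} (^-antitone 0≤a a≤1 i≤j)

  #-lists : (as : List A) (j : ℕ) → # (lists as j) ≡ # as ^ℚ j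
  #-lists as zero    = +-identityʳ 1ℚ
  #-lists {A = A} as (suc j) = begin
    # (concatMap extend as)            ≡⟨ ∑-concatMap (λ _ → 1ℚ) extend as ⟩
    ∑ (λ a → # (extend a)) as          ≡⟨ ∑-cong (λ a → trans (∑-map (λ _ → 1ℚ) (a ∷_) (lists as j)) (#-lists as j)) as ⟩
    ∑ (λ _ → # as ^ℚ j) as             ≡⟨ ∑-const (# as ^ℚ j) as ⟩
    # as * # as ^ℚ j                   ∎
    where
    open ≡-Reasoning
    extend : A → List (List A)
    extend a = map (a ∷_) (lists as j)

  geometric : {x : ℚ} → 0ℚ ≤ x → x + x ≤ 1ℚ → ∀ N → ∑ (x ^ℚ_) (applyDownFrom suc N) ≤ x + x
  geometric {x} 0≤x 2x≤1 N = ≤-trans (≤-+ʳ (+-mono-≤ (0≤^ 0≤x (suc N)) (0≤^ 0≤x (suc N)))) (withTail N)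
    where
    withTail : ∀ N → ∑ (x ^ℚ_) (applyDownFrom suc N) + (x ^ℚ suc N + x ^ℚ suc N) ≤ x + x
    withTail zero    = ≤-reflexive (trans (+-identityˡ _) (cong₂ _+_ (*-identityʳ x) (*-identityʳ x)))
    withTail (suc N) = begin
      (y + S) + (x * y + x * y) ≡⟨ solve 3 (λ x y S → (y :+ S) :+ (x :* y :+ x :* y) := S :+ y :+ (x :+ x) :* y)
                                           refl x y S ⟩
      S + y + (x + x) * y       ≤⟨ +-monoʳ-≤ (S + y) (*-monoʳ-≤-nonNeg y {{nonNegative (0≤^ 0≤x (suc N))}} 2x≤1) ⟩
      S + y + 1ℚ * y            ≡⟨ solve 2 (λ y S → S :+ y :+ con 1ℚ :* y := S :+ (y :+ y)) refl y S ⟩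
      S + (y + y)               ≤⟨ withTail N ⟩
      x + x                     ∎
      where
      open ≤-Reasoning
      y = x ^ℚ suc N
      S = ∑ (x ^ℚ_) (applyDownFrom suc N)

module ProductMeasure where

  open Sums
  open FinSubsets using (_⊆ᵇ_; ∅⊆ᵇ)
  open import Data.Bool using (Bool; true; false; if_then_else_; T)
  open import Data.Fin.Subset using (Subset; ∣_∣; ⊥)
  open import Data.Fin.Subset.Properties using (∣⊥∣≡0)
  open import Data.List using (List; []; _∷_; _++_; map)
  open import Data.List.Relation.Unary.Any using (Any)
  open import Data.Nat using (ℕ; zero; suc)
  open import Data.Rational using (ℚ; 0ℚ; 1ℚ; _+_; _*_; _-_; -_; _≤_)
  open import Data.Rational.Properties
  open import Data.Vec using ([]; _∷_)
  open import Relation.Binary.PropositionalEquality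
    using (_≡_; refl; sym; trans; cong; cong₂; subst; module ≡-Reasoning)

  1-p+p≡1 : ∀ p → (1ℚ - p) + p ≡ 1ℚ
  1-p+p≡1 p = trans (+-assoc 1ℚ (- p) p) (trans (cong (1ℚ +_) (+-inverseˡ p)) (+-identityʳ 1ℚ))

  if-* : (c : Bool) (a w : ℚ) → (if c then a * w else 0ℚ) ≡ a * (if c then w else 0ℚ)
  if-* true  a w = refl
  if-* false a w = sym (*-zeroʳ a)

  ∑-weight-⊇ : (p : ℚ) (m : ℕ) (Q : Subset m) →
               ∑ (λ H → if Q ⊆ᵇ H then weight p H else 0ℚ) (allSubsets m) ≡ p ^ℚ ∣ Q ∣
  ∑-weight-⊇ p zero    []      = +-identityʳ 1ℚ
  ∑-weight-⊇ p (suc m) (q ∷ Q) = begin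
    ∑ F (map (false ∷_) Hs ++ map (true ∷_) Hs)
      ≡⟨ ∑-++ F (map (false ∷_) Hs) _ ⟩
    ∑ F (map (false ∷_) Hs) + ∑ F (map (true ∷_) Hs)
      ≡⟨ cong₂ _+_ (∑-map F (false ∷_) Hs) (∑-map F (true ∷_) Hs) ⟩
    ∑ (λ H → F (false ∷ H)) Hs + ∑ (λ H → F (true ∷ H)) Hs
      ≡⟨ cases q ⟩
    p ^ℚ ∣ q ∷ Q ∣ ∎
    where
    open ≡-Reasoning
    Hs = allSubsets m
    F : Subset (suc m) → ℚ
    F H = if (q ∷ Q) ⊆ᵇ H then weight p H else 0ℚ
    G : Subset m → ℚ
    G H = if Q ⊆ᵇ H then weight p H else 0ℚ
    ∑-scaled : (a : ℚ) → ∑ (λ H → if Q ⊆ᵇ H then a * weight p H else 0ℚ) Hs ≡ a * p ^ℚ ∣ Q ∣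
    ∑-scaled a = trans (∑-cong (λ H → if-* (Q ⊆ᵇ H) a (weight p H)) Hs)
                       (trans (∑-*ˡ a G Hs) (cong (a *_) (∑-weight-⊇ p m Q)))
    cases : ∀ q → ∑ (λ H → if (q ∷ Q) ⊆ᵇ (false ∷ H) then weight p (false ∷ H) else 0ℚ) Hs
                + ∑ (λ H → if (q ∷ Q) ⊆ᵇ (true ∷ H) then weight p (true ∷ H) else 0ℚ) Hs
                ≡ p ^ℚ ∣ q ∷ Q ∣
    cases true  = trans (cong₂ _+_ (∑-zero Hs) (∑-scaled p)) (+-identityˡ _)
    cases false = begin
      ∑ _ Hs + ∑ _ Hs                              ≡⟨ cong₂ _+_ (∑-scaled (1ℚ - p)) (∑-scaled p) ⟩
      (1ℚ - p) * p ^ℚ ∣ Q ∣ + p * p ^ℚ ∣ Q ∣       ≡⟨ sym (*-distribʳ-+ _ (1ℚ - p) p) ⟩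
      ((1ℚ - p) + p) * p ^ℚ ∣ Q ∣                  ≡⟨ cong (_* p ^ℚ ∣ Q ∣) (1-p+p≡1 p) ⟩
      1ℚ * p ^ℚ ∣ Q ∣                              ≡⟨ *-identityˡ _ ⟩
      p ^ℚ ∣ Q ∣                                   ∎

  ∑-weight≡1 : (p : ℚ) (m : ℕ) → ∑ (weight p) (allSubsets m) ≡ 1ℚ
  ∑-weight≡1 p m = begin
    ∑ (weight p) (allSubsets m)
      ≡⟨ ∑-cong (λ H → cong (λ c → if c then weight p H else 0ℚ) (sym (∅⊆ᵇ H))) (allSubsets m) ⟩
    ∑ (λ H → if ⊥ ⊆ᵇ H then weight p H else 0ℚ) (allSubsets m)
      ≡⟨ ∑-weight-⊇ p m ⊥ ⟩
    p ^ℚ ∣ ⊥ {m} ∣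
      ≡⟨ cong (p ^ℚ_) (∣⊥∣≡0 m) ⟩
    1ℚ ∎
    where open ≡-Reasoning

  0≤1-p : {p : ℚ} → p ≤ 1ℚ → 0ℚ ≤ 1ℚ - p
  0≤1-p {p} p≤1 = subst (_≤ 1ℚ - p) (+-inverseʳ 1ℚ) (+-monoʳ-≤ 1ℚ (neg-antimono-≤ p≤1))

  0≤weight : {p : ℚ} → 0ℚ ≤ p → p ≤ 1ℚ → {m : ℕ} (H : Subset m) → 0ℚ ≤ weight p H
  0≤weight 0≤p p≤1 []          = nonNegative⁻¹ 1ℚ
  0≤weight 0≤p p≤1 (true ∷ H)  = 0≤* 0≤p (0≤weight 0≤p p≤1 H)
  0≤weight 0≤p p≤1 (false ∷ H) = 0≤* (0≤1-p p≤1) (0≤weight 0≤p p≤1 H)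

  0≤if : {c : Bool} {w : ℚ} → 0ℚ ≤ w → 0ℚ ≤ (if c then w else 0ℚ)
  0≤if {true}  0≤w = 0≤w
  0≤if {false} 0≤w = ≤-refl

  union-bound : {p : ℚ} → 0ℚ ≤ p → p ≤ 1ℚ → {m : ℕ} (good : Subset m → Bool) (Qs : List (Subset m)) →
                (∀ H → good H ≡ false → Any (λ Q → T (Q ⊆ᵇ H)) Qs) →
                1ℚ - ∑ (λ Q → p ^ℚ ∣ Q ∣) Qs ≤ ∑ (λ H → if good H then weight p H else 0ℚ) (allSubsets m)
  union-bound {p} 0≤p p≤1 {m} good Qs bad⇒covered = begin
    1ℚ - ∑Q
      ≡⟨ cong (_- ∑Q) (sym (∑-weight≡1 p m)) ⟩
    ∑ (weight p) Hs - ∑Q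
      ≤⟨ +-monoˡ-≤ (- ∑Q) (∑-mono Hs (λ {H} _ → weight≤ H)) ⟩
    ∑ (λ H → Good H + Bad H) Hs - ∑Q
      ≡⟨ cong (_- ∑Q) (trans (∑-+ Good Bad Hs) (cong (∑ Good Hs +_) ∑Bad)) ⟩
    (∑ Good Hs + ∑Q) - ∑Q
      ≡⟨ +-assoc (∑ Good Hs) ∑Q (- ∑Q) ⟩
    ∑ Good Hs + (∑Q - ∑Q)
      ≡⟨ trans (cong (∑ Good Hs +_) (+-inverseʳ ∑Q)) (+-identityʳ _) ⟩
    ∑ Good Hs ∎
    where
    open ≤-Reasoning
    Hs = allSubsets m
    ∑Q = ∑ (λ Q → p ^ℚ ∣ Q ∣) Qs
    Good Bad : Subset m → ℚ
    Good H = if good H then weight p H else 0ℚ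
    Bad H  = ∑ (λ Q → if Q ⊆ᵇ H then weight p H else 0ℚ) Qs
    ∑Bad : ∑ Bad Hs ≡ ∑ (λ Q → p ^ℚ ∣ Q ∣) Qs
    ∑Bad = trans (∑-swap _ Hs Qs) (∑-cong (∑-weight-⊇ p m) Qs)
    0≤summand : ∀ c H → 0ℚ ≤ (if c then weight p H else 0ℚ)
    0≤summand c H = 0≤if {c} (0≤weight 0≤p p≤1 H)
    weight≤summand : ∀ c H → T c → weight p H ≤ (if c then weight p H else 0ℚ)
    weight≤summand true H _ = ≤-refl
    weight≤ : ∀ H → weight p H ≤ Good H + Bad H
    weight≤ H with good H in eq
    ... | true  = ≤-+ʳ (∑-nonneg (λ Q → 0≤summand (Q ⊆ᵇ H) H) Qs)
    ... | false = ≤-trans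
                    (∑-≥-Any (λ Q → 0≤summand (Q ⊆ᵇ H) H) (λ {Q} → weight≤summand (Q ⊆ᵇ H) H)
                             (bad⇒covered H eq))
                    (≤-+ˡ ≤-refl)

  module _ (n k : ℕ) (p : ℚ) (good : Hypergraph n k → Bool) where

    -- probTrue sums with a function local to its where block; unification solves the meta
    -- sumProb to that function once allSubsets (numKSets n k) is abstracted.
    mutual
      private
        sumProb : List (Hypergraph n k) → ℚ
        sumProb = _

      probTrue≡∑ : probTrue n k p good ≡ ∑ (λ H → if good H then weight p H else 0ℚ) (allSubsets (numKSets n k))
      probTrue≡∑ with allSubsets (numKSets n k)
      ... | Hs = ∑-unique {F = sumProb} _ refl (λ _ _ → refl) Hs

module ColumnSpace where

  open import Data.Bool using (true; false)
  open import Data.Fin using (Fin; zero; suc)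
  open import Data.Fin.Subset using (Subset)
  open import Data.Integer using (ℤ; +_; _+_; _-_; _*_)
  import Data.Integer.Properties as ℤ
  open import Data.Integer.Solver using (module +-*-Solver)
  open import Data.List using (List; []; _∷_; _++_; length)
  open import Data.List.Relation.Unary.All using (All; []; _∷_)
  open import Data.Nat using (ℕ)
  open import Data.Product using (∃; _,_)
  open import Data.Sum using (inj₁; inj₂)
  open import Data.Vec.Functional using () renaming (_∷_ to _◂_)
  open import Relation.Binary.PropositionalEquality
    using (_≡_; _≢_; _≗_; refl; sym; trans; cong; module ≡-Reasoning)
  open import Relation.Nullary using (contradiction)
  open +-*-Solver

  private variable
    n : ℕ

  -- Defs.InImage as a record, so that the list of columns can be inferred from the type.
  record Im (es : List (Subset n)) (x : Fin n → ℤ) : Set where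
    constructor _,_
    field
      coefficients : Fin (length es) → ℤ
      represents   : ∀ v → x v ≡ applyM es coefficients v

  TorsionFree : List (Subset n) → Set
  TorsionFree {n} es = ∀ (x : Fin n → ℤ) (m : ℤ) → m ≢ + 0 → Im es (λ v → m * x v) → Im es x

  minusColumn : (Fin n → ℤ) → ℤ → Subset n → Fin n → ℤ
  minusColumn x c e v = x v - c * Mentry v e

  Im-resp : {es : List (Subset n)} {x x′ : Fin n → ℤ} → x ≗ x′ → Im es x → Im es x′
  Im-resp x≗x′ (y , x≡My) = y , λ v → trans (sym (x≗x′ v)) (x≡My v)

  Im-∷⁻ : {e : Subset n} {es : List (Subset n)} {x : Fin n → ℤ} →
          Im (e ∷ es) x → ∃ λ c → Im es (minusColumn x c e)
  Im-∷⁻ {e = e} {x = x} (y , x≡My) = y zero , ((λ j → y (suc j)) , λ v → shift (x v) (Mentry v e) (x≡My v))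
    where
    shift : ∀ a m {r} → a ≡ m * y zero + r → a - y zero * m ≡ r
    shift a m {r} refl = solve 3 (λ m c r → (m :* c :+ r) :- c :* m := r) refl m (y zero) r

  Im-∷⁺ : {e : Subset n} {es : List (Subset n)} {x : Fin n → ℤ} (c : ℤ) →
          Im es (minusColumn x c e) → Im (e ∷ es) x
  Im-∷⁺ {e = e} {x = x} c (y , x-ce≡My) = c ◂ y , λ v → unshift (x v) (Mentry v e) (x-ce≡My v)
    where
    unshift : ∀ a m {r} → a - c * m ≡ r → a ≡ m * c + r
    unshift a m refl = solve 3 (λ a m c → a := m :* c :+ (a :- c :* m)) refl a m c

  minusColumn-comm : (x : Fin n → ℤ) (c c′ : ℤ) (e e′ : Subset n) →
                     minusColumn (minusColumn x c e) c′ e′ ≗ minusColumn (minusColumn x c′ e′) c e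
  minusColumn-comm x c c′ e e′ v =
    solve 5 (λ a c m c′ m′ → a :- c :* m :- c′ :* m′ := a :- c′ :* m′ :- c :* m)
            refl (x v) c (Mentry v e) c′ (Mentry v e′)

  Im-remove⁻ : (as : List (Subset n)) {e : Subset n} {bs : List (Subset n)} {x : Fin n → ℤ} →
               Im (as ++ e ∷ bs) x → ∃ λ c → Im (as ++ bs) (minusColumn x c e)
  Im-remove⁻ []       x∈Im = Im-∷⁻ x∈Im
  Im-remove⁻ (a ∷ as) {e} {x = x} x∈Im with c₀ , h₀ ← Im-∷⁻ x∈Im with c , h ← Im-remove⁻ as h₀ =
    c , Im-∷⁺ c₀ (Im-resp (minusColumn-comm x c₀ c a e) h)

  Im-remove⁺ : (as : List (Subset n)) {e : Subset n} {bs : List (Subset n)} {x : Fin n → ℤ} (c : ℤ) →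
               Im (as ++ bs) (minusColumn x c e) → Im (as ++ e ∷ bs) x
  Im-remove⁺ []       c h = Im-∷⁺ c h
  Im-remove⁺ (a ∷ as) {e} {x = x} c h with c₀ , h₀ ← Im-∷⁻ h =
    Im-∷⁺ c₀ (Im-remove⁺ as c (Im-resp (minusColumn-comm x c c₀ e a) h₀))

  applyM-row-zero : {v : Fin n} (es : List (Subset n)) → All (λ f → member v f ≡ false) es →
                    ∀ y → applyM es y v ≡ + 0
  applyM-row-zero []       []          y = refl
  applyM-row-zero (f ∷ es) (v∉f ∷ v∉es) y rewrite v∉f =
    trans (ℤ.+-identityˡ _) (applyM-row-zero es v∉es (λ j → y (suc j)))

  Mentry²≡1 : (v : Fin n) (e : Subset n) → member v e ≡ true → Mentry v e * Mentry v e ≡ + 1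
  Mentry²≡1 v e v∈e with member v e | even (below v e)
  Mentry²≡1 v e refl | true | true  = refl
  Mentry²≡1 v e refl | true | false = refl

  TorsionFree-[] : TorsionFree {n} []
  TorsionFree-[] x m m≢0 (y , mx≡0) = y , λ v → x≡0 (ℤ.i*j≡0⇒i≡0∨j≡0 m (mx≡0 v))
    where
    x≡0 : ∀ {v} → _ → x v ≡ + 0
    x≡0 (inj₁ m≡0) = contradiction m≡0 m≢0
    x≡0 (inj₂ xv≡0) = xv≡0

  TorsionFree-insert : (as : List (Subset n)) {e : Subset n} {bs : List (Subset n)} (v : Fin n) →
                       member v e ≡ true → All (λ f → member v f ≡ false) (as ++ bs) →
                       TorsionFree (as ++ bs) → TorsionFree (as ++ e ∷ bs)
  TorsionFree-insert as {e} {bs} v v∈e v∉as++bs tf x m m≢0 mx∈Im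
    with c , (y , h) ← Im-remove⁻ as mx∈Im =
    Im-remove⁺ as d (tf (minusColumn x d e) m m≢0 (y , λ w → trans (rescale w) (h w)))
    where
    s = Mentry v e
    d = x v * s
    cs≡mxv : c * s ≡ m * x v
    cs≡mxv = sym (ℤ.i-j≡0⇒i≡j _ _ (trans (h v) (applyM-row-zero (as ++ bs) v∉as++bs y)))
    c≡md : c ≡ m * d
    c≡md = begin
      c            ≡⟨ sym (ℤ.*-identityʳ c) ⟩
      c * + 1      ≡⟨ cong (c *_) (sym (Mentry²≡1 v e v∈e)) ⟩
      c * (s * s)  ≡⟨ sym (ℤ.*-assoc c s s) ⟩
      c * s * s    ≡⟨ cong (_* s) cs≡mxv ⟩
      m * x v * s  ≡⟨ ℤ.*-assoc m (x v) s ⟩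
      m * d        ∎
      where open ≡-Reasoning
    rescale : ∀ w → m * minusColumn x d e w ≡ minusColumn (λ u → m * x u) c e w
    rescale w rewrite c≡md =
      solve 4 (λ m a d t → m :* (a :- d :* t) := m :* a :- m :* d :* t) refl m (x w) d (Mentry w e)

module BergeCycles where

  open Lists
  open FinSubsets
  open ColumnSpace
  open import Data.Bool using (true; false)
  import Data.Bool.Properties as Bool
  open import Data.Fin using (Fin; toℕ)
  import Data.Fin as Fin
  import Data.Fin.Properties as Fin
  open import Data.Fin.Subset using (Subset; ∣_∣)
  open import Data.List using (List; []; _∷_; _++_; map; length; allFin; lookup)
  open import Data.List.Membership.Propositional using (_∈_; find)
  open import Data.List.Membership.Propositional.Properties using (∈-allFin; ∈-∃++)
  open import Data.List.Properties using (length-++-sucʳ)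
  open import Data.List.Relation.Unary.All as All using (All; []; _∷_; all?)
  open import Data.List.Relation.Unary.Any as Any using (Any; here; there; any?; index)
  open import Data.List.Relation.Unary.Any.Properties using (lookup-index)
  open import Data.List.Relation.Unary.Unique.Propositional using (Unique; []; _∷_)
  open import Data.Nat using (ℕ; zero; suc; _+_; _≤_; _<_; z≤n; s≤s)
  open import Data.Nat.Properties
    using (≤-refl; ≤-trans; <⇒≤; n<1+n; +-suc; +-identityʳ; m≤m+n; anyUpTo?; m≤n⇒∃[o]m+o≡n; ≤∧≢⇒<)
  open import Data.Product using (∃; _×_; _,_; proj₁; proj₂)
  open import Data.Unit using (⊤)
  import Data.Vec.Properties as Vec
  open import Function using (_∘_)
  open import Relation.Binary.Definitions using (DecidableEquality)
  open import Relation.Binary.PropositionalEquality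
    using (_≡_; _≢_; refl; sym; trans; cong; subst)
  open import Relation.Nullary using (¬_; Dec; yes; no; contradiction; ¬?)
  open import Relation.Nullary.Decidable using (_×-dec_; _→-dec_; decidable-stable)
  open import Relation.Unary using (Decidable)

  private variable
    n : ℕ

  _≟ˢ_ : DecidableEquality (Subset n)
  _≟ˢ_ = Vec.≡-dec Bool._≟_

  least : {P : ℕ → Set} → Decidable P → ∀ {j} → P j → ∃ λ i → P i × (∀ {y} → y < i → ¬ P y)
  least {P = P} P? {j} Pj = search (suc j) ≤-refl Pj
    where
    search : ∀ fuel {j} → j < fuel → P j → ∃ λ i → P i × (∀ {y} → y < i → ¬ P y)
    search (suc fuel) {j} (s≤s j≤fuel) Pj with anyUpTo? P? j
    ... | no  none           = j , Pj , λ y<j Py → none (_ , y<j , Py)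
    ... | yes (i , i<j , Pi) = search fuel (≤-trans i<j j≤fuel) Pi

  State : ℕ → Set
  State n = Subset n × Fin n

  Link : State n → State n → Set
  Link (f , a) (_ , b) = member a f ≡ true × member b f ≡ true × a ≢ b

  LinksTo : State n → List (State n) → Set
  LinksTo z []           = ⊤
  LinksTo z (s ∷ [])     = Link s z
  LinksTo z (s ∷ s′ ∷ r) = Link s s′ × LinksTo z (s′ ∷ r)

  -- The Berge cycle f₀ a₀ f₁ a₁ … fₗ₋₁ aₗ₋₁ is the list of states (fᵢ , aᵢ): the edges are
  -- distinct and aᵢ ≠ aᵢ₊₁ both lie in fᵢ, indices taken mod l.
  record BergeCycle (es : List (Subset n)) : Set where
    field
      start    : State n
      rest     : List (State n)
      linked   : LinksTo start (start ∷ rest)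
      distinct : Unique (map proj₁ (start ∷ rest))
      inside   : All ((_∈ es) ∘ proj₁) (start ∷ rest)

  BergeCycle-mono : {es es′ : List (Subset n)} → (∀ {f} → f ∈ es → f ∈ es′) → BergeCycle es → BergeCycle es′
  BergeCycle-mono es⊆es′ C =
    record { start = start ; rest = rest ; linked = linked ; distinct = distinct ; inside = All.map es⊆es′ inside }
    where open BergeCycle C

  PrivateVertex : List (Subset n) → Subset n → Fin n → Set
  PrivateVertex es e v = member v e ≡ true × All (λ f → member v f ≡ true → f ≡ e) es

  HasLeaf : List (Subset n) → Set
  HasLeaf {n} es = Any (λ e → Any (PrivateVertex es e) (allFin n)) es

  hasLeaf? : (es : List (Subset n)) → Dec (HasLeaf es)
  hasLeaf? {n} es = any? (λ e → any? (λ v → (member v e Bool.≟ true)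
                                            ×-dec all? (λ f → (member v f Bool.≟ true) →-dec (f ≟ˢ e)) es)
                                     (allFin n)) es

  noLeaf⇒next : {es : List (Subset n)} → ¬ HasLeaf es → ∀ {f} → f ∈ es → ∀ b → member b f ≡ true →
                ∃ λ f′ → f′ ∈ es × member b f′ ≡ true × f′ ≢ f
  noLeaf⇒next {es = es} noLeaf {f} f∈ b b∈f
    with any? (λ f′ → (member b f′ Bool.≟ true) ×-dec ¬? (f′ ≟ˢ f)) es
  ... | yes found = find found
  ... | no  none  = contradiction (Any.map (λ { refl → Any.map (λ { refl → b∈f , onlyF }) (∈-allFin b) }) f∈) noLeaf
    where
    onlyF : All (λ f′ → member b f′ ≡ true → f′ ≡ f) es
    onlyF = All.tabulate λ {f′} f′∈ b∈f′ →
      decidable-stable (f′ ≟ˢ f) λ f′≢f → none (Any.map (λ { refl → b∈f′ , f′≢f }) f′∈)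

  module Walk (es : List (Subset n))
    (other : ∀ {f} → f ∈ es → ∀ a → ∃ λ b → member b f ≡ true × b ≢ a)
    (next  : ∀ {f} → f ∈ es → ∀ b → member b f ≡ true → ∃ λ f′ → f′ ∈ es × member b f′ ≡ true × f′ ≢ f)
    where

    record Position : Set where
      constructor position
      field
        edge     : Subset n
        edge∈es  : edge ∈ es
        vertex   : Fin n
        vertex∈  : member vertex edge ≡ true

    step : Position → Position
    step (position f f∈ a a∈f) =
      let b , b∈f , _ = other f∈ a
          f′ , f′∈ , b∈f′ , _ = next f∈ b b∈f
      in position f′ f′∈ b b∈f′

    module _ (p₀ : Position) where

      walk : ℕ → Position
      walk zero    = p₀
      walk (suc t) = step (walk t)

      E : ℕ → Subset n
      E = Position.edge ∘ walk

      A : ℕ → Fin n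
      A = Position.vertex ∘ walk

      E∈es : ∀ t → E t ∈ es
      E∈es = Position.edge∈es ∘ walk

      A∈E : ∀ t → member (A t) (E t) ≡ true
      A∈E = Position.vertex∈ ∘ walk

      A-next∈E : ∀ t → member (A (suc t)) (E t) ≡ true
      A-next∈E t with position f f∈ a _ ← walk t = proj₁ (proj₂ (other f∈ a))

      A-next≢A : ∀ t → A (suc t) ≢ A t
      A-next≢A t with position f f∈ a _ ← walk t = proj₂ (proj₂ (other f∈ a))

      E-next≢E : ∀ t → E (suc t) ≢ E t
      E-next≢E t with position f f∈ a _ ← walk t =
        let b , b∈f , _ = other f∈ a in proj₂ (proj₂ (proj₂ (next f∈ b b∈f)))

      Repeat : ℕ → Set
      Repeat j = ∃ λ i → i < j × E i ≡ E j

      Repeat? : Decidable Repeat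
      Repeat? y = anyUpTo? (λ x → E x ≟ˢ E y) y

      some-repeat : ∃ Repeat
      some-repeat with i , j , i<j , same ← Fin.pigeonhole (n<1+n (length es)) (index ∘ E∈es ∘ toℕ) =
        toℕ j , toℕ i , i<j ,
        trans (lookup-index (E∈es (toℕ i))) (trans (cong (lookup es) same) (sym (lookup-index (E∈es (toℕ j)))))

      segment : ℕ → ℕ → List (State n)
      segment u zero    = []
      segment u (suc c) = (E u , A u) ∷ segment (suc u) c

      linked-segment : ∀ u c z → Link (E (u + c) , A (u + c)) z → LinksTo z (segment u (suc c))
      linked-segment u zero    z last rewrite +-identityʳ u = last
      linked-segment u (suc c) z last =
        (A∈E u , A-next∈E u , A-next≢A u ∘ sym)
        , linked-segment (suc u) c z (subst (λ t → Link (E t , A t) z) (+-suc u c) last)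

      ∈-segment⁻ : ∀ {f} u c → f ∈ map proj₁ (segment u c) → ∃ λ t → u ≤ t × t < u + c × f ≡ E t
      ∈-segment⁻ u (suc c) (here refl) = u , ≤-refl , subst (u <_) (sym (+-suc u c)) (s≤s (m≤m+n u c)) , refl
      ∈-segment⁻ u (suc c) (there f∈) with t , u<t , t<u+c , refl ← ∈-segment⁻ (suc u) c f∈ =
        t , <⇒≤ u<t , subst (t <_) (sym (+-suc u c)) t<u+c , refl

      distinct-segment : ∀ u c → (∀ {t₁ t₂} → u ≤ t₁ → t₁ < t₂ → t₂ < u + c → E t₁ ≢ E t₂) →
                         Unique (map proj₁ (segment u c))
      distinct-segment u zero    _        = []
      distinct-segment u (suc c) distinct =
        All.tabulate (λ f∈ → let t , u<t , t<u+c , f≡Et = ∈-segment⁻ (suc u) c f∈ in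
                               λ Eu≡f → distinct ≤-refl u<t (shift t<u+c) (trans Eu≡f f≡Et))
        ∷ distinct-segment (suc u) c (λ u<t₁ t₁<t₂ t₂<u+c → distinct (<⇒≤ u<t₁) t₁<t₂ (shift t₂<u+c))
        where
        shift : ∀ {t} → t < suc u + c → t < u + suc c
        shift {t} = subst (t <_) (sym (+-suc u c))

      inside-segment : ∀ u c → All ((_∈ es) ∘ proj₁) (segment u c)
      inside-segment u zero    = []
      inside-segment u (suc c) = E∈es u ∷ inside-segment (suc u) c

      -- The first repeated edge Eᵢ = Eⱼ gives distinct edges Eᵢ … Eⱼ₋₁, entered at Aᵢ … Aⱼ₋₁ and
      -- left at Aᵢ₊₁ … Aⱼ. The cycle re-enters Eᵢ at Aⱼ, which must differ from the exit vertex Aᵢ₊₁;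
      -- if it does not, Eᵢ is dropped and the cycle closes up at Eᵢ₊₁.
      module _ (i o : ℕ) where

        private
          t = suc i + o
          within : ∀ {t′} → t′ < suc i + suc o → t′ < suc t
          within {t′} = subst (t′ <_) (+-suc (suc i) o)

        closeAt : E i ≡ E (suc t) → (∀ {t₁ t₂} → t₁ < t₂ → t₂ < suc t → E t₁ ≢ E t₂) → BergeCycle es
        closeAt Ei≡Et+1 before with A (suc t) Fin.≟ A (suc i)
        ... | yes At+1≡Ai+1 = record
          { start    = E (suc i) , A (suc i)
          ; rest     = segment (suc (suc i)) o
          ; linked   = linked-segment (suc i) o _
                         (A∈E t , subst (λ a → member a (E t) ≡ true) At+1≡Ai+1 (A-next∈E t) ,
                          λ At≡Ai+1 → A-next≢A t (trans At+1≡Ai+1 (sym At≡Ai+1)))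
          ; distinct = distinct-segment (suc i) (suc o) (λ _ t₁<t₂ → before t₁<t₂ ∘ within)
          ; inside   = inside-segment (suc i) (suc o)
          }
        ... | no  At+1≢Ai+1 = record
          { start    = E i , A (suc t)
          ; rest     = segment (suc i) (suc o)
          ; linked   = (subst (λ f → member (A (suc t)) f ≡ true) (sym Ei≡Et+1) (A∈E (suc t)) , A-next∈E i , At+1≢Ai+1)
                       , linked-segment (suc i) o _ (A∈E t , A-next∈E t , A-next≢A t ∘ sym)
          ; distinct = All.tabulate Ei∉segment
                       ∷ distinct-segment (suc i) (suc o) (λ _ t₁<t₂ → before t₁<t₂ ∘ within)
          ; inside   = E∈es i ∷ inside-segment (suc i) (suc o)
          }
          where
          Ei∉segment : ∀ {f} → f ∈ map proj₁ (segment (suc i) (suc o)) → E i ≢ f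
          Ei∉segment f∈ with t′ , i<t′ , t′<end , refl ← ∈-segment⁻ (suc i) (suc o) f∈ = before i<t′ (within t′<end)

      cycle : BergeCycle es
      cycle with j , (i , i<j , Ei≡Ej) , minimal ← least Repeat? (proj₂ some-repeat)
        with o , refl ← m≤n⇒∃[o]m+o≡n (≤∧≢⇒< i<j λ i+1≡j → E-next≢E i (trans (cong E i+1≡j) (sym Ei≡Ej))) =
        closeAt i o Ei≡Ej (λ t₁<t₂ t₂<j Et₁≡Et₂ → minimal t₂<j (_ , t₁<t₂ , Et₁≡Et₂))

  leafless⇒BergeCycle : {es : List (Subset n)} {e : Subset n} → e ∈ es → All (λ f → 2 ≤ ∣ f ∣) es →
                        ¬ HasLeaf es → BergeCycle es
  leafless⇒BergeCycle {es = es} {e} e∈ big noLeaf with a , a∈e ← element e (≤-trans (s≤s z≤n) (All.lookup big e∈)) =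
    Walk.cycle es (otherElement _ ∘ All.lookup big) (noLeaf⇒next noLeaf) (Walk.position e e∈ a a∈e)

  acyclic⇒TorsionFree : (es : List (Subset n)) → Unique es → All (λ f → 2 ≤ ∣ f ∣) es →
                        ¬ BergeCycle es → TorsionFree es
  acyclic⇒TorsionFree {n} es = peel (suc (length es)) es ≤-refl
    where
    leafless : (es : List (Subset n)) → All (λ f → 2 ≤ ∣ f ∣) es → ¬ HasLeaf es → ¬ BergeCycle es → TorsionFree es
    leafless []      _   _      _       = TorsionFree-[]
    leafless (e ∷ _) big noLeaf acyclic = contradiction (leafless⇒BergeCycle (here refl) big noLeaf) acyclic

    peel : ∀ m (es : List (Subset n)) → length es < m → Unique es → All (λ f → 2 ≤ ∣ f ∣) es →
           ¬ BergeCycle es → TorsionFree es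
    peel (suc m) es (s≤s len) u big acyclic with hasLeaf? es
    ... | no  noLeaf = leafless es big noLeaf acyclic
    ... | yes leaf
      with e , e∈ , leafAt ← find leaf
      with v , _ , v∈e , onlyE ← find leafAt
      with as , bs , refl ← ∈-∃++ e∈
      with e∉ , u′ ← Unique-remove as u =
      TorsionFree-insert as v v∈e v∉others
        (peel m (as ++ bs) (subst (_≤ m) (length-++-sucʳ as e bs) len) u′
              (All.tabulate (All.lookup big ∘ ∈-insert as)) (acyclic ∘ BergeCycle-mono (∈-insert as)))
      where
      v∉others : All (λ f → member v f ≡ false) (as ++ bs)
      v∉others = All.tabulate λ f∈ → Bool.¬-not {y = true} λ v∈f →
        e∉ (subst (_∈ as ++ bs) (All.lookup onlyE (∈-insert as f∈) v∈f) f∈)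

module CycleEvents (n k : ℕ) where

  open Lists
  open FinSubsets
  open BergeCycles using (State; LinksTo; BergeCycle; _≟ˢ_)
  open import Data.Bool using (Bool; true; false; not; T)
  open import Data.Bool.ListAction using (any)
  open import Data.Bool.Properties using (T-≡; T-not-≡; not-injective)
  open import Data.Fin using (Fin)
  open import Data.Fin.Subset using (Subset; ∣_∣)
  open import Data.List using (List; []; _∷_; _++_; map; length; concatMap; filter; take; allFin; applyDownFrom)
  open import Data.List.Membership.Propositional using (_∈_)
  open import Data.List.Membership.Propositional.Properties
    using (∈-map⁺; ∈-map⁻; ∈-concatMap⁺; ∈-filter⁺; ∈-allFin; ∈-applyDownFrom⁺)
  open import Data.List.Relation.Unary.All as All using (All; []; _∷_; all?)
  import Data.List.Relation.Unary.All.Properties as All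
  open import Data.List.Relation.Unary.Any as Any using (Any)
  open import Data.List.Relation.Unary.Any.Properties using (any⁺; any⁻)
  open import Data.List.Relation.Unary.Unique.Propositional using (Unique)
  open import Data.Nat using (ℕ; suc; _∸_; _≤_)
  open import Data.Product using (∃₂; _×_; _,_; proj₁; proj₂)
  open import Function using (_∘_)
  open import Function.Bundles using (Equivalence)
  open import Relation.Binary.PropositionalEquality
    using (_≡_; refl; sym; trans; cong; cong₂; subst)
  open import Relation.Nullary using (¬_; contradiction)
  open import Relation.Nullary.Decidable using (_×-dec_)
  open import Relation.Unary using (Decidable)

  open import Data.List.Membership.DecPropositional (_≟ˢ_ {n}) using (_∈?_)
  open import Data.List.Relation.Unary.Unique.DecPropositional (_≟ˢ_ {n}) using (unique?)

  KS : List (Subset n)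
  KS = kSets n k

  blocks : List (List (Fin n))
  blocks = lists (allFin n) (k ∸ 1)

  -- Block bᵢ lists vertex aᵢ of the cycle followed by the k − 2 vertices of fᵢ outside {aᵢ, aᵢ₊₁};
  -- fᵢ is recovered from bᵢ and the head aᵢ₊₁ of the next block, the last one from z = [a₀].
  cycleEdges : List (Fin n) → List (List (Fin n)) → List (Subset n)
  cycleEdges z []           = []
  cycleEdges z (b ∷ [])     = fromList (z ++ b) ∷ []
  cycleEdges z (b ∷ b′ ∷ r) = fromList (take 1 b′ ++ b) ∷ cycleEdges z (b′ ∷ r)

  edgeSets : List (List (Fin n)) → List (Subset n)
  edgeSets []       = []
  edgeSets (b ∷ bs) = cycleEdges (take 1 b) (b ∷ bs)

  length-cycleEdges : (z : List (Fin n)) (bs : List (List (Fin n))) → length (cycleEdges z bs) ≡ length bs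
  length-cycleEdges z []           = refl
  length-cycleEdges z (b ∷ [])     = refl
  length-cycleEdges z (b ∷ b′ ∷ r) = cong suc (length-cycleEdges z (b′ ∷ r))

  length-edgeSets : (bs : List (List (Fin n))) → length (edgeSets bs) ≡ length bs
  length-edgeSets []       = refl
  length-edgeSets (b ∷ bs) = length-cycleEdges (take 1 b) (b ∷ bs)

  Valid : List (Subset n) → Set
  Valid fs = Unique fs × All (_∈ KS) fs

  valid? : Decidable Valid
  valid? fs = unique? fs ×-dec all? (_∈? KS) fs

  event : List (Subset n) → Subset (numKSets n k)
  event fs = indicator (_∈? fs) KS

  candidates : ℕ → List (List (Subset n))
  candidates l = filter valid? (map edgeSets (lists blocks l))

  -- Lengths up to numKSets n k suffice: the edges of a Berge cycle are distinct k-sets.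
  events : List (Subset (numKSets n k))
  events = concatMap (λ l → map event (candidates l)) (applyDownFrom suc (numKSets n k))

  good : Hypergraph n k → Bool
  good H = not (any (_⊆ᵇ H) events)

  chain⇒blocks : (z s : State n) (r : List (State n)) → LinksTo z (s ∷ r) → All (λ s → ∣ proj₁ s ∣ ≡ k) (s ∷ r) →
             ∃₂ λ xs bs → All (λ b → length b ≡ k ∸ 1) ((proj₂ s ∷ xs) ∷ bs) × length bs ≡ length r
                          × cycleEdges (proj₂ z ∷ []) ((proj₂ s ∷ xs) ∷ bs) ≡ map proj₁ (s ∷ r)
  chain⇒blocks (_ , a₀) (f , a) [] (a∈f , a₀∈f , a≢a₀) (∣f∣≡k ∷ [])
    with xs , f≡ , size ← splitEdge f a∈f a₀∈f a≢a₀ =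
    xs , [] , cong (_∸ 1) (trans size ∣f∣≡k) ∷ [] , refl , cong (_∷ []) f≡
  chain⇒blocks z (f , a) ((f′ , a′) ∷ r) ((a∈f , a′∈f , a≢a′) , links) (∣f∣≡k ∷ sizes)
    with xs′ , bs′ , lengths , len , edges≡ ← chain⇒blocks z (f′ , a′) r links sizes
    with xs , f≡ , size ← splitEdge f a∈f a′∈f a≢a′ =
    xs , (a′ ∷ xs′) ∷ bs′ , cong (_∸ 1) (trans size ∣f∣≡k) ∷ lengths , cong suc len , cong₂ _∷_ f≡ edges≡

  block∈blocks : {b : List (Fin n)} → length b ≡ k ∸ 1 → b ∈ blocks
  block∈blocks {b} len = subst (λ j → b ∈ lists (allFin n) j) len (∈-lists⁺ (All.tabulate λ {x} _ → ∈-allFin x))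

  good⇒acyclic : (H : Hypergraph n k) → good H ≡ true → ¬ BergeCycle (edges {n} {k} H)
  good⇒acyclic H goodH record { start = start ; rest = rest ; linked = linked ; distinct = distinct ; inside = inside }
    with xs , bs , lengths , len , edges≡ ← chain⇒blocks start start rest linked (All.map (∈-kSets⁻ ∘ select-⊆ H) inside)
    = contradiction (any⁺ (_⊆ᵇ H) (Any.map (λ { refl → Equivalence.from T-≡ event⊆H }) event∈events)) notAny
    where
    d = (proj₂ start ∷ xs) ∷ bs
    fs = map proj₁ (start ∷ rest)
    fs⊆edges : All (_∈ edges {n} {k} H) fs
    fs⊆edges = All.map⁺ inside
    fs⊆KS : All (_∈ KS) fs
    fs⊆KS = All.map (select-⊆ H) fs⊆edges
    d≤N : length d ≤ numKSets n k
    d≤N = subst (_≤ numKSets n k) (trans (cong length (sym edges≡)) (length-edgeSets d))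
                (Unique⇒length≤ distinct (All.lookup fs⊆KS))
    fs∈candidates : fs ∈ candidates (length d)
    fs∈candidates = ∈-filter⁺ valid? (subst (_∈ _) edges≡ (∈-map⁺ edgeSets (∈-lists⁺ (All.map block∈blocks lengths))))
                              (distinct , fs⊆KS)
    event∈events : event fs ∈ events
    event∈events = ∈-concatMap⁺ (λ l → map event (candidates l))
                     (Any.map (λ { refl → ∈-map⁺ event fs∈candidates }) (∈-applyDownFrom⁺ suc d≤N))
    event⊆H : event fs ⊆ᵇ H ≡ true
    event⊆H = indicator-⊆ᵇ (_∈? fs) H (Unique-kSets n k) (λ _ f∈fs → All.lookup fs⊆edges f∈fs)
    notAny : ¬ T (any (_⊆ᵇ H) events)
    notAny = subst T (Equivalence.to T-not-≡ (Equivalence.from T-≡ goodH))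

  bad⇒covered : (H : Hypergraph n k) → good H ≡ false → Any (T ∘ (_⊆ᵇ H)) events
  bad⇒covered H badH = any⁻ (_⊆ᵇ H) events (Equivalence.from T-≡ (not-injective {y = true} badH))

  length≤∣event∣ : {fs : List (Subset n)} → Valid fs → length fs ≤ ∣ event fs ∣
  length≤∣event∣ {fs} (u , fs⊆KS) =
    subst (length fs ≤_) (sym (∣indicator∣ (_∈? fs) KS))
          (Unique⇒length≤ u λ f∈ → ∈-filter⁺ (_∈? fs) (All.lookup fs⊆KS f∈) f∈)

  length-candidate : ∀ {l fs} → fs ∈ map edgeSets (lists blocks l) → length fs ≡ l
  length-candidate {l} fs∈ with d , d∈ , refl ← ∈-map⁻ edgeSets fs∈ = trans (length-edgeSets d) (∈-lists⁻ blocks l d∈)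

module EventBound (n k : ℕ) {p : ℚ} (0≤p : 0ℚ ℚ.≤ p) (p≤1 : p ℚ.≤ 1ℚ) where

  open Lists
  open Sums
  open CycleEvents n k
  open import Data.Fin.Subset using (∣_∣)
  open import Data.Integer using (+_)
  open import Data.List using (map; length; allFin; applyDownFrom)
  open import Data.List.Membership.Propositional using (_∈_)
  open import Data.List.Properties using (length-tabulate)
  open import Data.Nat using (suc; _∸_; _^_)
  import Data.Nat as ℕ
  open import Data.Rational using (_*_; _/_; _≤_)
  open import Data.Rational.Properties using (≤-trans; ≤-reflexive; *-comm; module ≤-Reasoning)
  open import Relation.Binary.PropositionalEquality using (_≡_; sym; trans; cong; subst)

  ρ : ℚ
  ρ = p * (+ (n ^ (k ∸ 1)) / 1)

  #blocks : # blocks ≡ + (n ^ (k ∸ 1)) / 1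
  #blocks = trans (#≡length blocks) (cong (λ m → + m / 1) (trans (length-lists (allFin n) (k ∸ 1)) n^[k-1]))
    where
    n^[k-1] : length (allFin n) ^ (k ∸ 1) ≡ n ^ (k ∸ 1)
    n^[k-1] = cong (_^ (k ∸ 1)) (length-tabulate (λ i → i))

  ∑-candidates : ∀ l → ∑ (λ fs → p ^ℚ ∣ event fs ∣) (candidates l) ≤ ρ ^ℚ l
  ∑-candidates l = begin
    ∑ (λ fs → p ^ℚ ∣ event fs ∣) (candidates l)  ≤⟨ ∑-filter-mono valid? (λ _ → 0≤^ 0≤p l) cycleLists bound ⟩
    ∑ (λ _ → p ^ℚ l) cycleLists                  ≡⟨ ∑-const (p ^ℚ l) cycleLists ⟩
    # cycleLists * p ^ℚ l                        ≡⟨ cong (_* p ^ℚ l) #cycleLists ⟩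
    # blocks ^ℚ l * p ^ℚ l                       ≡⟨ sym (^-distrib-* (# blocks) p l) ⟩
    (# blocks * p) ^ℚ l                          ≡⟨ cong (_^ℚ l) (trans (*-comm (# blocks) p) (cong (p *_) #blocks)) ⟩
    ρ ^ℚ l                                       ∎
    where
    open ≤-Reasoning
    cycleLists = map edgeSets (lists blocks l)
    #cycleLists : # cycleLists ≡ # blocks ^ℚ l
    #cycleLists = trans (∑-map (λ _ → 1ℚ) edgeSets (lists blocks l)) (#-lists blocks l)
    bound : ∀ {fs} → fs ∈ cycleLists → Valid fs → p ^ℚ ∣ event fs ∣ ≤ p ^ℚ l
    bound {fs} fs∈ valid =
      ^-antitone 0≤p p≤1 {l} {∣ event fs ∣} (subst (ℕ._≤ ∣ event fs ∣) (length-candidate fs∈) (length≤∣event∣ valid))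

  ∑-events : ∑ (λ Q → p ^ℚ ∣ Q ∣) events ≤ ∑ (ρ ^ℚ_) (applyDownFrom suc (numKSets n k))
  ∑-events = begin
    ∑ (λ Q → p ^ℚ ∣ Q ∣) events
      ≡⟨ ∑-concatMap (λ Q → p ^ℚ ∣ Q ∣) (λ l → map event (candidates l)) lengths ⟩
    ∑ (λ l → ∑ (λ Q → p ^ℚ ∣ Q ∣) (map event (candidates l))) lengths
      ≤⟨ ∑-mono lengths (λ {l} _ → ≤-trans (≤-reflexive (∑-map (λ Q → p ^ℚ ∣ Q ∣) event (candidates l))) (∑-candidates l)) ⟩
    ∑ (ρ ^ℚ_) lengths ∎
    where
    open ≤-Reasoning
    lengths = applyDownFrom suc (numKSets n k)

open import Data.Bool using (Bool; true)
open import Data.Nat using (ℕ; _≥_; _^_; _∸_)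
open import Data.Integer using (+_)
open import Data.Rational using (ℚ; 0ℚ; 1ℚ; _≤_; _<_; _*_; _-_; _/_)
open import Data.Product using (Σ; ∃; _×_)
open import Relation.Binary.PropositionalEquality using (_≡_)

open import Data.Bool using (if_then_else_)
open import Data.Fin.Subset using (∣_∣)
import Data.List.Relation.Unary.All as All
import Data.Nat as ℕ
import Data.Nat.Properties as ℕ
open import Data.Product using (_,_)
open import Data.Rational using (½; _+_; _⊓_; positive)
open import Data.Rational.Properties
open import Data.Rational.Solver using (module +-*-Solver)
open import Data.Sum using (inj₁; inj₂)
open import Relation.Binary.PropositionalEquality using (refl; sym; subst)
open Lists using (select-⊆; Unique-select)
open FinSubsets using (Unique-kSets; ∈-kSets⁻)
open Sums using (∑; _^ℚ_; 0≤*; geometric)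
open ProductMeasure using (union-bound; probTrue≡∑)
open ColumnSpace using (TorsionFree; module Im)
open BergeCycles using (acyclic⇒TorsionFree)
open EventBound using (∑-events)

module _ {n k : ℕ} where

  TorsionFree⇒CokerTorsionFree : (H : Hypergraph n k) → TorsionFree (edges {n} {k} H) → CokerTorsionFree {n} {k} H
  TorsionFree⇒CokerTorsionFree H tf x m m≢0 (y , mx≡My) = Im.coefficients x∈Im , Im.represents x∈Im
    where x∈Im = tf x m m≢0 record { coefficients = y ; represents = mx≡My }

  good⇒CokerTorsionFree : 2 ℕ.≤ k → (H : Hypergraph n k) → CycleEvents.good n k H ≡ true → CokerTorsionFree {n} {k} H
  good⇒CokerTorsionFree 2≤k H goodH = TorsionFree⇒CokerTorsionFree H
    (acyclic⇒TorsionFree (edges {n} {k} H) (Unique-select H (Unique-kSets n k))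
      (All.tabulate λ f∈ → subst (2 ℕ.≤_) (sym (∈-kSets⁻ (select-⊆ H f∈))) 2≤k)
      (CycleEvents.good⇒acyclic n k H goodH))

  1-2ρ≤probTrue-good : {p : ℚ} → 0ℚ ≤ p → p ≤ 1ℚ → let ρ = p * (+ (n ^ (k ∸ 1)) / 1) in ρ + ρ ≤ 1ℚ →
                       1ℚ - (ρ + ρ) ≤ probTrue n k p (CycleEvents.good n k)
  1-2ρ≤probTrue-good {p} 0≤p p≤1 2ρ≤1 = begin
    1ℚ - (ρ + ρ)
      ≤⟨ +-monoʳ-≤ 1ℚ (neg-antimono-≤ (≤-trans (∑-events n k 0≤p p≤1) (geometric 0≤ρ 2ρ≤1 (numKSets n k)))) ⟩
    1ℚ - ∑ (λ Q → p ^ℚ ∣ Q ∣) events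
      ≤⟨ union-bound 0≤p p≤1 good events bad⇒covered ⟩
    ∑ (λ H → if good H then weight p H else 0ℚ) (allSubsets (numKSets n k))
      ≡⟨ sym (probTrue≡∑ n k p good) ⟩
    probTrue n k p good ∎
    where
    open CycleEvents n k using (good; events; bad⇒covered)
    open ≤-Reasoning
    ρ = p * (+ (n ^ (k ∸ 1)) / 1)
    0≤ρ : 0ℚ ≤ ρ
    0≤ρ = 0≤* 0≤p (nonNegative⁻¹ _ {{normalize-nonNeg (n ^ (k ∸ 1)) 1}})

0<⊓ : {a b : ℚ} → 0ℚ < a → 0ℚ < b → 0ℚ < a ⊓ b
0<⊓ {a} {b} 0<a 0<b with ⊓-sel a b
... | inj₁ a⊓b≡a = subst (0ℚ <_) (sym a⊓b≡a) 0<a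
... | inj₂ a⊓b≡b = subst (0ℚ <_) (sym a⊓b≡b) 0<b

0<½* : {a : ℚ} → 0ℚ < a → 0ℚ < ½ * a
0<½* {a} 0<a = positive⁻¹ (½ * a) {{pos*pos⇒pos ½ a {{positive 0<a}}}}

½*+½*≡id : ∀ a → ½ * a + ½ * a ≡ a
½*+½*≡id = solve 1 (λ a → con ½ :* a :+ con ½ :* a := a) refl
  where open +-*-Solver

proposition1p3 : (k : ℕ) → k ≥ 3 →
    (p : ℕ → ℚ) → (∀ n → (0ℚ ≤ p n) × (p n ≤ 1ℚ)) →
    -- p = o(1 / n^(k-1))
    (∀ (ε : ℚ) → 0ℚ < ε → ∃ λ (N : ℕ) → ∀ n → n ≥ N → p n * ((+ (n ^ (k ∸ 1))) / 1) ≤ ε) →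
    -- a.a.s. coker M(H) is torsion-free, H ~ H_k(n, p(n))
    (∀ (ε : ℚ) → 0ℚ < ε → ∃ λ (N : ℕ) → ∀ n → n ≥ N →
      ∃ λ (good : Hypergraph n k → Bool) →
        (∀ H → good H ≡ true → CokerTorsionFree {n} {k} H)
        × (1ℚ - ε ≤ probTrue n k (p n) good))
proposition1p3 k k≥3 p p∈[0,1] p=o ε 0<ε =
  let m = ε ⊓ 1ℚ
      N , ρ≤½m = p=o (½ * m) (0<½* (0<⊓ 0<ε (positive⁻¹ 1ℚ)))
  in N , λ n n≥N →
    let 0≤p , p≤1 = p∈[0,1] n
        2ρ≤m = subst (_ ≤_) (½*+½*≡id m) (+-mono-≤ (ρ≤½m n n≥N) (ρ≤½m n n≥N))
    in CycleEvents.good n k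
     , good⇒CokerTorsionFree {n} {k} (ℕ.≤-trans (ℕ.n≤1+n 2) k≥3)
     , ≤-trans (+-monoʳ-≤ 1ℚ (neg-antimono-≤ (≤-trans 2ρ≤m (p⊓q≤p ε 1ℚ))))
               (1-2ρ≤probTrue-good {n} {k} 0≤p p≤1 (≤-trans 2ρ≤m (p⊓q≤q ε 1ℚ)))
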